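{- Let $C_n$ be the cycle on $n$ vertices and $\pi$ a uniformly random ordering of its vertices. Then with probability tending to $1$ as $n\to\infty$, every connected component of $T_2(C_n,\pi)$ contains $O(\log n)$ vertices (i.e., at most $K\log n$ vertices for some absolute constant $K$).
   Context: For a graph $G$ and an ordering $\pi$ of its vertices, $T_2(G,\pi)$ is the subgraph of $G$ induced on the vertices having at most one neighbor preceding them in $\pi$. -}

module Defs where

open import Data.Nat using (ℕ; zero; suc; _+_; _*_; _≤_; _<_; _!)
open import Data.Nat.Logarithm using (⌊log₂_⌋)
open import Data.Fin using (Fin; toℕ)
open import Data.Vec using (Vec; lookup)
open import Data.List using (List; length)
open import Data.List.Relation.Unary.All using (All)
open import Data.List.Relation.Unary.Unique.Propositional using (Unique)
open import Data.Product using (_×_; ∃)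
open import Data.Sum using (_⊎_)
open import Relation.Nullary using (¬_)
open import Relation.Binary.PropositionalEquality using (_≡_)
open import Relation.Binary.Construct.Closure.ReflexiveTransitive using (Star)

CycleAdj : (n : ℕ) → Fin n → Fin n → Set
CycleAdj n i j =
  ¬ (i ≡ j) ×
  ( (toℕ j ≡ suc (toℕ i)) ⊎ (toℕ i ≡ suc (toℕ j))
  ⊎ ((toℕ i ≡ 0) × (suc (toℕ j) ≡ n))
  ⊎ ((toℕ j ≡ 0) × (suc (toℕ i) ≡ n)) )

-- An ordering of the vertices is given by the rank σ[v] of each vertex v,
-- required to be a bijection Fin n → Fin n (surjective, hence bijective).
IsOrdering : (n : ℕ) → Vec (Fin n) n → Set
IsOrdering n σ = ∀ (r : Fin n) → ∃ λ v → lookup σ v ≡ r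

Precedes : {n : ℕ} → Vec (Fin n) n → Fin n → Fin n → Set
Precedes σ u v = toℕ (lookup σ u) < toℕ (lookup σ v)

InT2 : (n : ℕ) → Vec (Fin n) n → Fin n → Set
InT2 n σ v = ∀ u w → CycleAdj n u v → CycleAdj n w v →
             Precedes σ u v → Precedes σ w v → u ≡ w

T2Edge : (n : ℕ) → Vec (Fin n) n → Fin n → Fin n → Set
T2Edge n σ u w = InT2 n σ u × InT2 n σ w × CycleAdj n u w

ComponentsBounded : (n : ℕ) → Vec (Fin n) n → ℕ → Set
ComponentsBounded n σ b =
  ∀ (v : Fin n) → InT2 n σ v →
  ∀ (L : List (Fin n)) → Unique L → All (λ u → Star (T2Edge n σ) v u) L →
  length L ≤ b

Good : ℕ → (n : ℕ) → Vec (Fin n) n → Set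
Good K n σ = IsOrdering n σ × ComponentsBounded n σ (K * ⌊log₂ n ⌋)

module Submission where

open import Defs

open import Data.Empty using (⊥)
open import Data.Fin using (Fin; zero; suc; toℕ; fromℕ; fromℕ<; inject₁; inject≤; cast; _↑ʳ_; punchIn; punchOut)
  renaming (_≟_ to _≟ᶠ_)
open import Data.Fin.Properties
  using (toℕ<n; toℕ-injective; toℕ-fromℕ<; fromℕ<-injective; toℕ-inject≤; inject≤-injective; toℕ-cast; toℕ-↑ʳ;
         ↑ʳ-injective; punchIn-injective; punchIn-cancel-≤; punchIn-punchOut)
open import Data.List as List using (List; []; _∷_; length; upTo; _++_; filter; allFin; cartesianProductWith)
open import Data.List.Properties using (length-++; length-map; length-removeAt′; length-tabulate; length-upTo)
open import Data.List.Membership.Propositional using (_∈_; _─_)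
open import Data.List.Membership.Propositional.Properties
  using (∈-allFin; ∈-map⁺; ∈-map⁻; ∈-filter⁺; ∈-filter⁻; ∈-upTo⁺; ∈-++⁺ˡ; ∈-++⁺ʳ;
         ∈-cartesianProductWith⁺; ∈-cartesianProductWith⁻)
open import Data.List.Relation.Binary.Subset.Propositional using (_⊆_)
open import Data.List.Relation.Unary.All as All using (All; []; _∷_)
import Data.List.Relation.Unary.All.Properties as All
open import Data.List.Relation.Unary.AllPairs using ([]; _∷_)
open import Data.List.Relation.Unary.Any using (here; there; index)
open import Data.List.Relation.Unary.Unique.Propositional using (Unique)
import Data.List.Relation.Unary.Unique.Propositional.Properties as Unique
open import Data.Nat
  using (ℕ; zero; suc; _+_; _*_; _^_; _∸_; _≤_; _<_; _≤?_; _<?_; z≤n; s≤s; z<s; s≤s⁻¹; _!; NonZero; >-nonZero)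
open import Data.Nat.DivMod
  using (_mod_; _%_; _/_; m≡m%n+[m/n]*n; m%n<n; m/n*n≤m; m<n⇒m%n≡m; [m+kn]%n≡m%n; %-distribˡ-+; m%n%n≡m%n)
open import Data.Nat.GeneralisedArithmetic using (iterate; iterate-is-fold; +-is-fold)
open import Data.Nat.Logarithm using (⌊log₂_⌋; ⌊log₂⌋-mono-≤; ⌊log₂[2^n]⌋≡n)
open import Data.Nat.Properties
open import Algebra.Properties.CommutativeSemigroup *-commutativeSemigroup using (x∙yz≈y∙xz; interchange)
open import Data.Nat.Tactic.RingSolver using (solve-∀)
open import Data.Product using (∃; _×_; _,_; proj₁; proj₂; map₂)
open import Data.Sum using (_⊎_; inj₁; inj₂; swap)
open import Data.Vec as Vec using (Vec; []; _∷_; _∷ʳ_; lookup)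
open import Data.Vec.Properties using (lookup-map; ∷ʳ-injective)
open import Function using (_∘_)
open import Function.Definitions using (Injective)
open import Relation.Binary.Construct.Closure.ReflexiveTransitive using (Star; ε; _◅_)
open import Relation.Binary.PropositionalEquality
open import Relation.Nullary using (¬_; ¬?; yes; no; contradiction)
open import Relation.Nullary.Decidable using (_×-dec_)
open import Relation.Unary using (Decidable)

-- A peak, a vertex ranked after both of its neighbours, is not a vertex of T₂, and a walk
-- in T₂ stays on an arc between peaks; so if every window of B consecutive vertices
-- contains a peak, every component has at most 6B vertices.
--
-- Orderings are counted through their insertion codes, under which the ranks at which
-- disjoint groups of vertices are inserted are independent and uniform. In the unit of
-- four vertices starting at 4k, vertex 4k + 1 becomes a peak whenever the first three
-- insertion ranks straddle 2k + 1, which happens for at least 1/8 of the codes. A block of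
-- t = 12 ⌊log₂ n⌋ units therefore lacks a peak for at most (7/8)ᵗ of the orderings, and a
-- union bound over the fewer than 2^⌊log₂ n⌋ blocks leaves at most a fraction 1/(m + 1) of
-- bad orderings once n ≥ 2^(m+1). Blocks have B = 4t vertices, whence K = 6 · 4 · 12 = 288.

module _ {A : Set} where

  ∈-─⁺ : ∀ {x z} {ys : List A} (p : x ∈ ys) → z ∈ ys → z ≢ x → z ∈ ys ─ p
  ∈-─⁺ (here refl) (here refl) z≢x = contradiction refl z≢x
  ∈-─⁺ (here _)    (there z∈)  _   = z∈
  ∈-─⁺ (there _)   (here refl) _   = here refl
  ∈-─⁺ (there p)   (there z∈)  z≢x = there (∈-─⁺ p z∈ z≢x)

  Unique-⊆⇒length≤ : ∀ {xs ys : List A} → Unique xs → xs ⊆ ys → length xs ≤ length ys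
  Unique-⊆⇒length≤ {[]}              _              _     = z≤n
  Unique-⊆⇒length≤ {x ∷ xs} {ys} (x∉xs ∷ xs-unique) xs⊆ys =
    subst (suc (length xs) ≤_) (sym (length-removeAt′ ys (index x∈ys)))
      (s≤s (Unique-⊆⇒length≤ xs-unique λ z∈xs →
        ∈-─⁺ x∈ys (xs⊆ys (there z∈xs)) (λ z≡x → All.lookup x∉xs z∈xs (sym z≡x))))
    where
      x∈ys : x ∈ ys
      x∈ys = xs⊆ys (here refl)

  length-filter+length-filter-¬ : ∀ {P : A → Set} (P? : Decidable P) xs →
    length (filter P? xs) + length (filter (¬? ∘ P?) xs) ≡ length xs
  length-filter+length-filter-¬ P? [] = refl
  length-filter+length-filter-¬ P? (x ∷ xs) with P? x
  ... | yes _ = cong suc (length-filter+length-filter-¬ P? xs)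
  ... | no  _ = trans (+-suc _ _) (cong suc (length-filter+length-filter-¬ P? xs))

length-cartesianProductWith : ∀ {A B C : Set} (f : A → B → C) xs ys →
  length (cartesianProductWith f xs ys) ≡ length xs * length ys
length-cartesianProductWith f []       ys = refl
length-cartesianProductWith f (x ∷ xs) ys = begin
  length (List.map (f x) ys ++ cartesianProductWith f xs ys)
    ≡⟨ length-++ (List.map (f x) ys) ⟩
  length (List.map (f x) ys) + length (cartesianProductWith f xs ys)
    ≡⟨ cong₂ _+_ (length-map (f x) ys) (length-cartesianProductWith f xs ys) ⟩
  length ys + length xs * length ys
    ∎
  where open ≡-Reasoning

length-allFin : ∀ n → length (allFin n) ≡ n
length-allFin n = length-tabulate (λ i → i)

-- Insertion codes

-- Code a b lists, for the vertices a, …, b − 1 in turn, the rank at which each is inserted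
-- among the vertices before it; decode turns Code 0 n into the orderings of Fin n.
data Code : ℕ → ℕ → Set where
  done : ∀ {a} → Code a a
  _∷_  : ∀ {a b} → Fin (suc a) → Code (suc a) b → Code a b

Code-≤ : ∀ {a b} → Code a b → a ≤ b
Code-≤ done    = ≤-refl
Code-≤ (_ ∷ x) = <⇒≤ (Code-≤ x)

_++ᶜ_ : ∀ {a b c} → Code a b → Code b c → Code a c
done    ++ᶜ y = y
(r ∷ x) ++ᶜ y = r ∷ (x ++ᶜ y)

++ᶜ-assoc : ∀ {a b c d} (x : Code a b) (y : Code b c) (z : Code c d) →
            (x ++ᶜ y) ++ᶜ z ≡ x ++ᶜ (y ++ᶜ z)
++ᶜ-assoc done    y z = refl
++ᶜ-assoc (r ∷ x) y z = cong (r ∷_) (++ᶜ-assoc x y z)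

∷-injective : ∀ {a b} {r r' : Fin (suc a)} {x x' : Code (suc a) b} →
              _≡_ {A = Code a b} (r ∷ x) (r' ∷ x') → r ≡ r' × x ≡ x'
∷-injective refl = refl , refl

++ᶜ-injective : ∀ {a b c} (x x' : Code a b) {y y' : Code b c} →
                x ++ᶜ y ≡ x' ++ᶜ y' → x ≡ x' × y ≡ y'
++ᶜ-injective done     done      eq = refl , eq
++ᶜ-injective done     (_ ∷ x')  _  = contradiction (Code-≤ x') (n≮n _)
++ᶜ-injective (_ ∷ x)  done      _  = contradiction (Code-≤ x) (n≮n _)
++ᶜ-injective (r ∷ x)  (r' ∷ x') eq with ∷-injective eq
... | refl , eq' with ++ᶜ-injective x x' eq'
...   | refl , refl = refl , refl

_⊛_ : ∀ {a b} → List (Fin (suc a)) → List (Code (suc a) b) → List (Code a b)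
_⊛_ = cartesianProductWith _∷_

length-⊛ : ∀ {a b} (rs : List (Fin (suc a))) (xs : List (Code (suc a) b)) →
           length (rs ⊛ xs) ≡ length rs * length xs
length-⊛ = length-cartesianProductWith _∷_

⊛-unique : ∀ {a b} {rs : List (Fin (suc a))} {xs : List (Code (suc a) b)} →
           Unique rs → Unique xs → Unique (rs ⊛ xs)
⊛-unique = Unique.cartesianProductWith⁺ _∷_ ∷-injective

codes : ∀ {a b} k → k + a ≡ b → List (Code a b)
codes     zero    refl = done ∷ []
codes {a} (suc k) eq   = allFin (suc a) ⊛ codes k (trans (+-suc k a) eq)

codes-unique : ∀ {a b} k (eq : k + a ≡ b) → Unique (codes k eq)
codes-unique zero    refl = [] ∷ []
codes-unique (suc k) eq   = ⊛-unique (Unique.allFin⁺ _) (codes-unique k _)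

codes-complete : ∀ {a b} k (eq : k + a ≡ b) (x : Code a b) → x ∈ codes k eq
codes-complete     zero    refl done    = here refl
codes-complete     zero    refl (_ ∷ x) = contradiction (Code-≤ x) (n≮n _)
codes-complete {a} (suc k) eq   done    = contradiction (sym eq) (m≢1+n+m a)
codes-complete     (suc k) eq   (r ∷ x) =
  ∈-cartesianProductWith⁺ _∷_ (∈-allFin r) (codes-complete k _ x)

-- xs has as many elements as Code a b, namely b!/a!
FullSize : ∀ {a b} → List (Code a b) → Set
FullSize {a} {b} xs = a ! * length xs ≡ b !

codes-FullSize : ∀ {a b} k (eq : k + a ≡ b) → FullSize (codes k eq)
codes-FullSize         zero    refl = *-identityʳ _
codes-FullSize {a} {b} (suc k) eq = begin
  a ! * length (allFin (suc a) ⊛ xs)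
    ≡⟨ cong (a ! *_) (length-⊛ (allFin (suc a)) xs) ⟩
  a ! * (length (allFin (suc a)) * length xs)
    ≡⟨ cong (λ l → a ! * (l * length xs)) (length-allFin (suc a)) ⟩
  a ! * (suc a * length xs)
    ≡⟨ sym (*-assoc (a !) (suc a) (length xs)) ⟩
  a ! * suc a * length xs
    ≡⟨ cong (_* length xs) (*-comm (a !) (suc a)) ⟩
  suc a ! * length xs
    ≡⟨ codes-FullSize k (trans (+-suc k a) eq) ⟩
  b ! ∎
  where
    open ≡-Reasoning
    xs = codes k (trans (+-suc k a) eq)

_⊗_ : ∀ {a b c} → List (Code a b) → List (Code b c) → List (Code a c)
_⊗_ = cartesianProductWith _++ᶜ_

length-⊗ : ∀ {a b c} (xs : List (Code a b)) (ys : List (Code b c)) →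
           length (xs ⊗ ys) ≡ length xs * length ys
length-⊗ = length-cartesianProductWith _++ᶜ_

⊗-unique : ∀ {a b c} {xs : List (Code a b)} {ys : List (Code b c)} →
           Unique xs → Unique ys → Unique (xs ⊗ ys)
⊗-unique = Unique.cartesianProductWith⁺ _++ᶜ_ (λ {x} {x'} → ++ᶜ-injective x x')

⊗-FullSize : ∀ {a b c} (xs : List (Code a b)) (ys : List (Code b c)) →
             FullSize xs → FullSize ys → FullSize (xs ⊗ ys)
⊗-FullSize {a} {b} {c} xs ys xs-full ys-full = begin
  a ! * length (xs ⊗ ys)           ≡⟨ cong (a ! *_) (length-⊗ xs ys) ⟩
  a ! * (length xs * length ys)    ≡⟨ sym (*-assoc (a !) _ _) ⟩
  a ! * length xs * length ys      ≡⟨ cong (_* length ys) xs-full ⟩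
  b ! * length ys                  ≡⟨ ys-full ⟩
  c !                              ∎
  where open ≡-Reasoning

module _ (pos step : ℕ → ℕ) where

  ∏ : (∀ k → List (Code (pos k) (pos (step k)))) →
      ∀ k c → List (Code (pos k) (pos (iterate step k c)))
  ∏ L k zero    = done ∷ []
  ∏ L k (suc c) = L k ⊗ ∏ L (step k) c

  module _ {L : ∀ k → List (Code (pos k) (pos (step k)))} where

    ∏-unique : (∀ k → Unique (L k)) → ∀ k c → Unique (∏ L k c)
    ∏-unique L-unique k zero    = [] ∷ []
    ∏-unique L-unique k (suc c) = ⊗-unique (L-unique k) (∏-unique L-unique (step k) c)

    ∏-FullSize : (∀ k → FullSize (L k)) → ∀ k c → FullSize (∏ L k c)
    ∏-FullSize L-full k zero    = *-identityʳ _
    ∏-FullSize L-full k (suc c) = ⊗-FullSize (L k) (∏ L (step k) c) (L-full k) (∏-FullSize L-full (step k) c)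

insert : ∀ {a} → Fin (suc a) → Vec (Fin a) a → Vec (Fin (suc a)) (suc a)
insert r σ = Vec.map (punchIn r) σ ∷ʳ r

decodeFrom : ∀ {a b} → Vec (Fin a) a → Code a b → Vec (Fin b) b
decodeFrom σ done    = σ
decodeFrom σ (r ∷ x) = decodeFrom (insert r σ) x

decode : ∀ {n} → Code 0 n → Vec (Fin n) n
decode = decodeFrom []

decodeFrom-++ᶜ : ∀ {a b c} (σ : Vec (Fin a) a) (x : Code a b) (y : Code b c) →
                 decodeFrom σ (x ++ᶜ y) ≡ decodeFrom (decodeFrom σ x) y
decodeFrom-++ᶜ σ done    y = refl
decodeFrom-++ᶜ σ (r ∷ x) y = decodeFrom-++ᶜ (insert r σ) x y

map-injective : ∀ {A B : Set} {f : A → B} {m} → Injective _≡_ _≡_ f →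
                Injective _≡_ _≡_ (Vec.map {n = m} f)
map-injective f-inj {[]}     {[]}     _  = refl
map-injective f-inj {x ∷ xs} {y ∷ ys} eq with Data.Vec.Properties.∷-injective eq
... | fx≡fy , eq′ = cong₂ _∷_ (f-inj fx≡fy) (map-injective f-inj eq′)

insert-injective : ∀ {a} {r r' : Fin (suc a)} (σ σ' : Vec (Fin a) a) →
                   insert r σ ≡ insert r' σ' → r ≡ r' × σ ≡ σ'
insert-injective {r = r} σ σ' eq with ∷ʳ-injective (Vec.map (punchIn r) σ) _ eq
... | eq′ , refl = refl , map-injective (punchIn-injective r _ _) eq′

decodeFrom-injective : ∀ {a b} (σ σ' : Vec (Fin a) a) (x x' : Code a b) →
                       decodeFrom σ x ≡ decodeFrom σ' x' → σ ≡ σ' × x ≡ x'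
decodeFrom-injective σ σ' done     done      eq = eq , refl
decodeFrom-injective σ σ' done     (_ ∷ x')  _  = contradiction (Code-≤ x') (n≮n _)
decodeFrom-injective σ σ' (_ ∷ x)  done      _  = contradiction (Code-≤ x) (n≮n _)
decodeFrom-injective σ σ' (r ∷ x)  (r' ∷ x') eq with decodeFrom-injective _ _ x x' eq
... | eq′ , refl with insert-injective σ σ' eq′
...   | refl , σ≡σ' = σ≡σ' , refl

decode-injective : ∀ {n} {x x' : Code 0 n} → decode x ≡ decode x' → x ≡ x'
decode-injective {x = x} {x'} eq = proj₂ (decodeFrom-injective [] [] x x' eq)

lookup-∷ʳ-last : ∀ {A : Set} {m} (xs : Vec A m) (y : A) → lookup (xs ∷ʳ y) (fromℕ m) ≡ y
lookup-∷ʳ-last []       y = refl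
lookup-∷ʳ-last (_ ∷ xs) y = lookup-∷ʳ-last xs y

lookup-∷ʳ-inject₁ : ∀ {A : Set} {m} (xs : Vec A m) (y : A) (i : Fin m) →
                    lookup (xs ∷ʳ y) (inject₁ i) ≡ lookup xs i
lookup-∷ʳ-inject₁ (_ ∷ xs) y zero    = refl
lookup-∷ʳ-inject₁ (_ ∷ xs) y (suc i) = lookup-∷ʳ-inject₁ xs y i

insert-IsOrdering : ∀ {a} (r : Fin (suc a)) (σ : Vec (Fin a) a) →
                    IsOrdering a σ → IsOrdering (suc a) (insert r σ)
insert-IsOrdering {a} r σ σ-onto s with r ≟ᶠ s
... | yes refl = fromℕ a , lookup-∷ʳ-last (Vec.map (punchIn r) σ) r
... | no  r≢s  with σ-onto (punchOut r≢s)
...   | v , σv≡s′ = inject₁ v , (begin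
  lookup (insert r σ) (inject₁ v)       ≡⟨ lookup-∷ʳ-inject₁ (Vec.map (punchIn r) σ) r v ⟩
  lookup (Vec.map (punchIn r) σ) v      ≡⟨ lookup-map v (punchIn r) σ ⟩
  punchIn r (lookup σ v)                ≡⟨ cong (punchIn r) σv≡s′ ⟩
  punchIn r (punchOut r≢s)              ≡⟨ punchIn-punchOut r≢s ⟩
  s                                     ∎)
  where open ≡-Reasoning

decodeFrom-IsOrdering : ∀ {a b} (σ : Vec (Fin a) a) (x : Code a b) →
                        IsOrdering a σ → IsOrdering b (decodeFrom σ x)
decodeFrom-IsOrdering σ done    σ-ord = σ-ord
decodeFrom-IsOrdering σ (r ∷ x) σ-ord = decodeFrom-IsOrdering (insert r σ) x (insert-IsOrdering r σ σ-ord)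

decode-IsOrdering : ∀ {n} (x : Code 0 n) → IsOrdering n (decode x)
decode-IsOrdering x = decodeFrom-IsOrdering [] x (λ ())

-- Vertices keep their natural-number names as the ordering grows; rank σ i
-- is the rank of vertex i (junk value 0 when i is out of range).
rank : ∀ {n m} → Vec (Fin n) m → ℕ → ℕ
rank []      _       = 0
rank (r ∷ _) zero    = toℕ r
rank (_ ∷ σ) (suc i) = rank σ i

rank-lookup : ∀ {n m} (σ : Vec (Fin n) m) (v : Fin m) → rank σ (toℕ v) ≡ toℕ (lookup σ v)
rank-lookup (_ ∷ σ) zero    = refl
rank-lookup (_ ∷ σ) (suc v) = rank-lookup σ v

rank-fromℕ< : ∀ {n m i} (σ : Vec (Fin n) m) (i<m : i < m) →
              rank σ i ≡ toℕ (lookup σ (fromℕ< i<m))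
rank-fromℕ< σ i<m = trans (cong (rank σ) (sym (toℕ-fromℕ< i<m))) (rank-lookup σ _)

rank-∷ʳ : ∀ {n m i} (σ : Vec (Fin n) m) (r : Fin n) → i < m → rank (σ ∷ʳ r) i ≡ rank σ i
rank-∷ʳ {i = zero}  (_ ∷ σ) r _   = refl
rank-∷ʳ {i = suc i} (_ ∷ σ) r i<m = rank-∷ʳ σ r (s≤s⁻¹ i<m)

rank-∷ʳ-last : ∀ {n m} (σ : Vec (Fin n) m) (r : Fin n) → rank (σ ∷ʳ r) m ≡ toℕ r
rank-∷ʳ-last []      r = refl
rank-∷ʳ-last (_ ∷ σ) r = rank-∷ʳ-last σ r

rank-insert : ∀ {a i} (r : Fin (suc a)) (σ : Vec (Fin a) a) (i<a : i < a) →
              rank (insert r σ) i ≡ toℕ (punchIn r (lookup σ (fromℕ< i<a)))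
rank-insert {i = i} r σ i<a = begin
  rank (insert r σ) i                             ≡⟨ rank-∷ʳ (Vec.map (punchIn r) σ) r i<a ⟩
  rank (Vec.map (punchIn r) σ) i                  ≡⟨ rank-fromℕ< (Vec.map (punchIn r) σ) i<a ⟩
  toℕ (lookup (Vec.map (punchIn r) σ) (fromℕ< i<a)) ≡⟨ cong toℕ (lookup-map (fromℕ< i<a) (punchIn r) σ) ⟩
  toℕ (punchIn r (lookup σ (fromℕ< i<a)))         ∎
  where open ≡-Reasoning

toℕ-punchIn-< : ∀ {n} (i : Fin (suc n)) (j : Fin n) → toℕ j < toℕ i → toℕ (punchIn i j) ≡ toℕ j
toℕ-punchIn-< (suc i) zero    _       = refl
toℕ-punchIn-< (suc i) (suc j) j<i = cong suc (toℕ-punchIn-< i j (s≤s⁻¹ j<i))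

toℕ-punchIn-≥ : ∀ {n} (i : Fin (suc n)) (j : Fin n) → toℕ i ≤ toℕ j → toℕ (punchIn i j) ≡ suc (toℕ j)
toℕ-punchIn-≥ zero    j       _   = refl
toℕ-punchIn-≥ (suc i) (suc j) i≤j = cong suc (toℕ-punchIn-≥ i j (s≤s⁻¹ i≤j))

punchIn-mono-< : ∀ {n} (i : Fin (suc n)) (j k : Fin n) → toℕ j < toℕ k → toℕ (punchIn i j) < toℕ (punchIn i k)
punchIn-mono-< i j k j<k = ≰⇒> (λ ik≤ij → <⇒≱ j<k (punchIn-cancel-≤ i k j ik≤ij))

module _ {a i} (r : Fin (suc a)) (σ : Vec (Fin a) a) (i<a : i < a) where

  insert-below : rank σ i < toℕ r → rank (insert r σ) i < toℕ r
  insert-below σi<r rewrite rank-insert r σ i<a | rank-fromℕ< σ i<a =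
    subst (_< toℕ r) (sym (toℕ-punchIn-< r _ σi<r)) σi<r

  insert-above : toℕ r ≤ rank σ i → toℕ r < rank (insert r σ) i
  insert-above r≤σi rewrite rank-insert r σ i<a | rank-fromℕ< σ i<a =
    subst (toℕ r <_) (sym (toℕ-punchIn-≥ r _ r≤σi)) (s≤s r≤σi)

  insert-preserves-< : ∀ {j} (j<a : j < a) → rank σ i < rank σ j → rank (insert r σ) i < rank (insert r σ) j
  insert-preserves-< j<a σi<σj
    rewrite rank-insert r σ i<a | rank-insert r σ j<a | rank-fromℕ< σ i<a | rank-fromℕ< σ j<a =
    punchIn-mono-< r _ _ σi<σj

decodeFrom-preserves-< : ∀ {a b i j} (σ : Vec (Fin a) a) (x : Code a b) → i < a → j < a →
                         rank σ i < rank σ j → rank (decodeFrom σ x) i < rank (decodeFrom σ x) j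
decodeFrom-preserves-< σ done    i<a j<a σi<σj = σi<σj
decodeFrom-preserves-< σ (r ∷ x) i<a j<a σi<σj =
  decodeFrom-preserves-< (insert r σ) x (m<n⇒m<1+n i<a) (m<n⇒m<1+n j<a)
    (insert-preserves-< r σ i<a j<a σi<σj)

-- vertex 1 + p is a local maximum of the ranks
Peak : ∀ {n m} → Vec (Fin n) m → ℕ → Set
Peak σ p = rank σ p < rank σ (suc p) × rank σ (suc (suc p)) < rank σ (suc p)

decodeFrom-Peak : ∀ {a b p} (σ : Vec (Fin a) a) (x : Code a b) → suc (suc p) < a →
                  Peak σ p → Peak (decodeFrom σ x) p
decodeFrom-Peak {a} {p = p} σ x 2+p<a (rise , fall) =
  decodeFrom-preserves-< σ x p<a 1+p<a rise , decodeFrom-preserves-< σ x 2+p<a 1+p<a fall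
  where
    1+p<a : suc p < a
    1+p<a = <-trans (n<1+n _) 2+p<a
    p<a : p < a
    p<a = <-trans (n<1+n _) 1+p<a

insert³-Peak : ∀ {p} (σ : Vec (Fin p) p) c₀ c₁ c₂ → toℕ c₀ < toℕ c₁ → toℕ c₂ ≤ toℕ c₁ →
               Peak (insert c₂ (insert c₁ (insert c₀ σ))) p
insert³-Peak {p} σ c₀ c₁ c₂ c₀<c₁ c₂≤c₁ = rise , fall
  where
    σ₀ = insert c₀ σ
    σ₁ = insert c₁ σ₀
    σ₁-top : rank σ₁ (suc p) ≡ toℕ c₁
    σ₁-top = rank-∷ʳ-last (Vec.map (punchIn c₁) σ₀) c₁
    σ₁-rise : rank σ₁ p < rank σ₁ (suc p)
    σ₁-rise = subst (rank σ₁ p <_) (sym σ₁-top)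
      (insert-below c₁ σ₀ (n<1+n p) (subst (_< toℕ c₁) (sym (rank-∷ʳ-last (Vec.map (punchIn c₀) σ) c₀)) c₀<c₁))
    τ = insert c₂ σ₁
    rise : rank τ p < rank τ (suc p)
    rise = insert-preserves-< c₂ σ₁ (m<n⇒m<1+n (n<1+n p)) (n<1+n (suc p)) σ₁-rise
    fall : rank τ (suc (suc p)) < rank τ (suc p)
    fall = subst (_< rank τ (suc p)) (sym (rank-∷ʳ-last (Vec.map (punchIn c₂) σ₁) c₂))
      (insert-above c₂ σ₁ (n<1+n (suc p)) (subst (toℕ c₂ ≤_) (sym σ₁-top) c₂≤c₁))

Peak-¬InT2 : ∀ {n p} (σ : Vec (Fin n) n) (2+p<n : suc (suc p) < n) →
             Peak σ p → ¬ InT2 n σ (fromℕ< (<-trans (n<1+n (suc p)) 2+p<n))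
Peak-¬InT2 {n} {p} σ 2+p<n (rise , fall) inT2 =
  <-irrefl (fromℕ<-injective p (2 + p) p<n 2+p<n u≡w) (m<n⇒m<1+n (n<1+n p))
  where
    1+p<n : suc p < n
    1+p<n = <-trans (n<1+n (suc p)) 2+p<n
    p<n : p < n
    p<n = <-trans (n<1+n p) 1+p<n
    u = fromℕ< p<n
    v = fromℕ< 1+p<n
    w = fromℕ< 2+p<n
    u~v : CycleAdj n u v
    u~v = (λ u≡v → <-irrefl (fromℕ<-injective p (1 + p) p<n 1+p<n u≡v) (n<1+n p))
        , inj₁ (trans (toℕ-fromℕ< 1+p<n) (cong suc (sym (toℕ-fromℕ< p<n))))
    w~v : CycleAdj n w v
    w~v = (λ w≡v → <-irrefl (fromℕ<-injective (1 + p) (2 + p) 1+p<n 2+p<n (sym w≡v)) (n<1+n (suc p)))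
        , inj₂ (inj₁ (trans (toℕ-fromℕ< 2+p<n) (cong suc (sym (toℕ-fromℕ< 1+p<n)))))
    u≡w : u ≡ w
    u≡w = inT2 u w u~v w~v (subst₂ _<_ (rank-fromℕ< σ p<n) (rank-fromℕ< σ 1+p<n) rise)
                           (subst₂ _<_ (rank-fromℕ< σ 2+p<n) (rank-fromℕ< σ 1+p<n) fall)

-- the code inserts vertices p, 1 + p, 2 + p, lying in [lo, hi), so that 1 + p ends up a peak
record PeakIn {a b} (lo hi : ℕ) (x : Code a b) : Set where
  field
    {p}    : ℕ
    before : Code a p
    c₀     : Fin (suc p)
    c₁     : Fin (suc (suc p))
    c₂     : Fin (suc (suc (suc p)))
    after  : Code (suc (suc (suc p))) b
    split  : x ≡ before ++ᶜ (c₀ ∷ c₁ ∷ c₂ ∷ after)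
    rises  : toℕ c₀ < toℕ c₁
    falls  : toℕ c₂ ≤ toℕ c₁
    lo≤p   : lo ≤ p
    p+3≤hi : suc (suc (suc p)) ≤ hi

PeakIn-++ᶜʳ : ∀ {a b c lo hi} {x : Code a b} → PeakIn lo hi x → (y : Code b c) → PeakIn lo hi (x ++ᶜ y)
PeakIn-++ᶜʳ pk y = record
  { before = before ; c₀ = c₀ ; c₁ = c₁ ; c₂ = c₂ ; after = after ++ᶜ y
  ; split  = trans (cong (_++ᶜ y) split) (++ᶜ-assoc before (c₀ ∷ c₁ ∷ c₂ ∷ after) y)
  ; rises  = rises ; falls = falls ; lo≤p = lo≤p ; p+3≤hi = p+3≤hi
  }
  where open PeakIn pk

PeakIn-++ᶜˡ : ∀ {a b c lo hi} (x : Code a b) {y : Code b c} → PeakIn lo hi y → PeakIn lo hi (x ++ᶜ y)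
PeakIn-++ᶜˡ x pk = record
  { before = x ++ᶜ before ; c₀ = c₀ ; c₁ = c₁ ; c₂ = c₂ ; after = after
  ; split  = trans (cong (x ++ᶜ_) split) (sym (++ᶜ-assoc x before (c₀ ∷ c₁ ∷ c₂ ∷ after)))
  ; rises  = rises ; falls = falls ; lo≤p = lo≤p ; p+3≤hi = p+3≤hi
  }
  where open PeakIn pk

PeakIn-widen : ∀ {a b lo lo' hi hi'} {x : Code a b} → lo' ≤ lo → hi ≤ hi' → PeakIn lo hi x → PeakIn lo' hi' x
PeakIn-widen lo'≤lo hi≤hi' pk = record
  { before = before ; c₀ = c₀ ; c₁ = c₁ ; c₂ = c₂ ; after = after ; split = split
  ; rises = rises ; falls = falls ; lo≤p = ≤-trans lo'≤lo lo≤p ; p+3≤hi = ≤-trans p+3≤hi hi≤hi'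
  }
  where open PeakIn pk

PeakIn-¬InT2 : ∀ {n lo hi} {X : Code 0 n} → PeakIn lo hi X →
               ∃ λ q → lo ≤ toℕ q × toℕ q < hi × ¬ InT2 n (decode X) q
PeakIn-¬InT2 {n} {lo} {hi} {X} pk =
  fromℕ< 1+p<n , lo≤q , q<hi
  , subst (λ σ → ¬ InT2 n σ (fromℕ< 1+p<n)) (sym decode-X) (Peak-¬InT2 (decodeFrom τ after) 2+p<n peak)
  where
    open PeakIn pk
    2+p<n : suc (suc p) < n
    2+p<n = Code-≤ after
    1+p<n : suc p < n
    1+p<n = <-trans (n<1+n (suc p)) 2+p<n
    τ = insert c₂ (insert c₁ (insert c₀ (decode before)))
    decode-X : decode X ≡ decodeFrom τ after
    decode-X = trans (cong decode split) (decodeFrom-++ᶜ [] before (c₀ ∷ c₁ ∷ c₂ ∷ after))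
    peak : Peak (decodeFrom τ after) p
    peak = decodeFrom-Peak τ after (n<1+n (suc (suc p))) (insert³-Peak (decode before) c₀ c₁ c₂ rises falls)
    lo≤q : lo ≤ toℕ (fromℕ< 1+p<n)
    lo≤q = subst (lo ≤_) (sym (toℕ-fromℕ< 1+p<n)) (m≤n⇒m≤1+n lo≤p)
    q<hi : toℕ (fromℕ< 1+p<n) < hi
    q<hi = subst (_< hi) (sym (toℕ-fromℕ< 1+p<n)) (<-≤-trans (m<n⇒m<1+n (n<1+n (suc p))) p+3≤hi)

module _ (pos step : ℕ → ℕ) {L : ∀ k → List (Code (pos k) (pos (step k)))} where

  ∏-PeakIn : (∀ k → All (PeakIn (pos k) (pos (step k))) (L k)) →
             ∀ k c → All (λ X → ∀ j → j < c → PeakIn (pos (iterate step k j)) (pos (iterate step k (suc j))) X)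
                         (∏ pos step L k c)
  ∏-PeakIn L-peaks k zero    = (λ _ ()) ∷ []
  ∏-PeakIn L-peaks k (suc c) =
    All.cartesianProductWith⁺ (setoid _) (setoid _) _++ᶜ_ (L k) (∏ pos step L (step k) c) peaks
    where
      peaks : ∀ {x y} → x ∈ L k → y ∈ ∏ pos step L (step k) c →
              ∀ j → j < suc c → PeakIn (pos (iterate step k j)) (pos (iterate step k (suc j))) (x ++ᶜ y)
      peaks {y = y} x∈ y∈ zero    _       = PeakIn-++ᶜʳ (All.lookup (L-peaks k) x∈) y
      peaks {x = x} x∈ y∈ (suc j) 1+j<1+c =
        PeakIn-++ᶜˡ x (All.lookup (∏-PeakIn L-peaks (step k) c) y∈ j (s≤s⁻¹ 1+j<1+c))

-- Walks in an induced subgraph of the cycle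

opaque
  _⊕_ : ∀ {m} → Fin (suc m) → ℕ → Fin (suc m)
  _⊕_ {m} x k = (toℕ x + k) mod suc m

  toℕ-⊕ : ∀ {m} (x : Fin (suc m)) k → toℕ (x ⊕ k) ≡ (toℕ x + k) % suc m
  toℕ-⊕ x k = toℕ-fromℕ< _

⊕-reaches : ∀ {m} (x q : Fin (suc m)) {k} j → toℕ x + k ≡ toℕ q + j * suc m → x ⊕ k ≡ q
⊕-reaches {m} x q {k} j x+k≡q+jn = toℕ-injective (begin
  toℕ (x ⊕ k)              ≡⟨ toℕ-⊕ x k ⟩
  (toℕ x + k) % suc m      ≡⟨ cong (_% suc m) x+k≡q+jn ⟩
  (toℕ q + j * suc m) % suc m ≡⟨ [m+kn]%n≡m%n (toℕ q) j (suc m) ⟩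
  toℕ q % suc m            ≡⟨ m<n⇒m%n≡m (toℕ<n q) ⟩
  toℕ q                    ∎)
  where open ≡-Reasoning

⊕-⊕ : ∀ {m} (x : Fin (suc m)) a b → (x ⊕ a) ⊕ b ≡ x ⊕ (a + b)
⊕-⊕ {m} x a b = toℕ-injective (begin
  toℕ ((x ⊕ a) ⊕ b)                              ≡⟨ toℕ-⊕ (x ⊕ a) b ⟩
  (toℕ (x ⊕ a) + b) % suc m                      ≡⟨ cong (λ y → (y + b) % suc m) (toℕ-⊕ x a) ⟩
  ((toℕ x + a) % suc m + b) % suc m              ≡⟨ %-distribˡ-+ ((toℕ x + a) % suc m) b (suc m) ⟩
  ((toℕ x + a) % suc m % suc m + b % suc m) % suc m ≡⟨ cong (λ y → (y + b % suc m) % suc m) (m%n%n≡m%n (toℕ x + a) (suc m)) ⟩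
  ((toℕ x + a) % suc m + b % suc m) % suc m      ≡⟨ %-distribˡ-+ (toℕ x + a) b (suc m) ⟨
  (toℕ x + a + b) % suc m                        ≡⟨ cong (_% suc m) (+-assoc (toℕ x) a b) ⟩
  (toℕ x + (a + b)) % suc m                      ≡⟨ toℕ-⊕ x (a + b) ⟨
  toℕ (x ⊕ (a + b))                              ∎)
  where open ≡-Reasoning

⊕-+* : ∀ {m} (x : Fin (suc m)) a j → x ⊕ (a + j * suc m) ≡ x ⊕ a
⊕-+* {m} x a j = toℕ-injective (begin
  toℕ (x ⊕ (a + j * suc m))         ≡⟨ toℕ-⊕ x (a + j * suc m) ⟩
  (toℕ x + (a + j * suc m)) % suc m ≡⟨ cong (_% suc m) (+-assoc (toℕ x) a _) ⟨
  (toℕ x + a + j * suc m) % suc m   ≡⟨ [m+kn]%n≡m%n (toℕ x + a) j (suc m) ⟩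
  (toℕ x + a) % suc m               ≡⟨ toℕ-⊕ x a ⟨
  toℕ (x ⊕ a)                       ∎)
  where open ≡-Reasoning

CycleAdj⇒⊕ : ∀ {m} {w u : Fin (suc m)} → CycleAdj (suc m) w u → u ≡ w ⊕ 1 ⊎ u ≡ w ⊕ m
CycleAdj⇒⊕ {m} {w} {u} (_ , inj₁ u≡1+w) = inj₁ (sym (⊕-reaches w u 0 (begin
  toℕ w + 1                 ≡⟨ +-comm (toℕ w) 1 ⟩
  suc (toℕ w)               ≡⟨ u≡1+w ⟨
  toℕ u                     ≡⟨ +-identityʳ (toℕ u) ⟨
  toℕ u + 0                 ∎)))
  where open ≡-Reasoning
CycleAdj⇒⊕ {m} {w} {u} (_ , inj₂ (inj₁ w≡1+u)) = inj₂ (sym (⊕-reaches w u 1 (begin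
  toℕ w + m                 ≡⟨ cong (_+ m) w≡1+u ⟩
  suc (toℕ u) + m           ≡⟨ +-suc (toℕ u) m ⟨
  toℕ u + suc m             ≡⟨ cong (toℕ u +_) (+-identityʳ (suc m)) ⟨
  toℕ u + 1 * suc m         ∎)))
  where open ≡-Reasoning
CycleAdj⇒⊕ {m} {w} {u} (_ , inj₂ (inj₂ (inj₁ (w≡0 , 1+u≡n)))) = inj₂ (sym (⊕-reaches w u 0 (begin
  toℕ w + m                 ≡⟨ cong (_+ m) w≡0 ⟩
  m                         ≡⟨ suc-injective 1+u≡n ⟨
  toℕ u                     ≡⟨ +-identityʳ (toℕ u) ⟨
  toℕ u + 0                 ∎)))
  where open ≡-Reasoning
CycleAdj⇒⊕ {m} {w} {u} (_ , inj₂ (inj₂ (inj₂ (u≡0 , 1+w≡n)))) = inj₁ (sym (⊕-reaches w u 1 (begin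
  toℕ w + 1                 ≡⟨ +-comm (toℕ w) 1 ⟩
  suc (toℕ w)               ≡⟨ 1+w≡n ⟩
  suc m                     ≡⟨ +-identityʳ (suc m) ⟨
  1 * suc m                 ≡⟨ cong (_+ 1 * suc m) u≡0 ⟨
  toℕ u + 1 * suc m         ∎)))
  where open ≡-Reasoning

≤-suc-extend : ∀ {P : ℕ → Set} {k} → (∀ i → i ≤ k → P i) → P (suc k) → ∀ i → i ≤ suc k → P i
≤-suc-extend {k = k} below top i i≤1+k with m≤n⇒m<n∨m≡n i≤1+k
... | inj₁ i<1+k = below i (s≤s⁻¹ i<1+k)
... | inj₂ refl  = top

module _ {m : ℕ} (S : Fin (suc m) → Set) where

  Arc : ℕ → Fin (suc m) → Fin (suc m) → Set
  Arc d v u = ∃ λ k → u ≡ v ⊕ (k * d) × (∀ i → i ≤ k → S (v ⊕ (i * d)))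

  LeavesWithin : ℕ → ℕ → Set
  LeavesWithin d D = ∀ x → ∃ λ i → i < D × ¬ S (x ⊕ (i * d))

  arc-step : ∀ {d d̄ v w w'} → d + d̄ ≡ suc m → Arc d v w → S w' →
             w' ≡ w ⊕ d ⊎ w' ≡ w ⊕ d̄ → Arc d v w' ⊎ Arc d̄ v w'
  arc-step {d} {d̄} {v} _ (k , refl , inS) Sw' (inj₁ refl) =
    inj₁ (suc k , ahead , ≤-suc-extend inS (subst S ahead Sw'))
    where
      ahead : (v ⊕ (k * d)) ⊕ d ≡ v ⊕ (suc k * d)
      ahead = trans (⊕-⊕ v (k * d) d) (cong (v ⊕_) (+-comm (k * d) d))
  arc-step {d} {d̄} {v} _ (zero , refl , inS) Sw' (inj₂ refl) =
    inj₂ (1 , turned , ≤-suc-extend (λ { _ z≤n → inS 0 z≤n }) (subst S turned Sw'))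
    where
      turned : (v ⊕ 0) ⊕ d̄ ≡ v ⊕ (1 * d̄)
      turned = trans (⊕-⊕ v 0 d̄) (cong (v ⊕_) (sym (+-identityʳ d̄)))
  arc-step {d} {d̄} {v} d+d̄≡n (suc k , refl , inS) Sw' (inj₂ refl) =
    inj₁ (k , back , λ i i≤k → inS i (m≤n⇒m≤1+n i≤k))
    where
      back : (v ⊕ (suc k * d)) ⊕ d̄ ≡ v ⊕ (k * d)
      back = begin
        (v ⊕ (suc k * d)) ⊕ d̄        ≡⟨ ⊕-⊕ v (suc k * d) d̄ ⟩
        v ⊕ (d + k * d + d̄)          ≡⟨ cong (λ e → v ⊕ (e + d̄)) (+-comm d (k * d)) ⟩
        v ⊕ (k * d + d + d̄)          ≡⟨ cong (v ⊕_) (+-assoc (k * d) d d̄) ⟩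
        v ⊕ (k * d + (d + d̄))        ≡⟨ cong (λ e → v ⊕ (k * d + e)) (trans d+d̄≡n (sym (+-identityʳ (suc m)))) ⟩
        v ⊕ (k * d + 1 * suc m)      ≡⟨ ⊕-+* v (k * d) 1 ⟩
        v ⊕ (k * d)                  ∎
        where open ≡-Reasoning

  -- starting D − 1 steps behind x, the forward window is the backward window of x
  LeavesWithin-backwards : ∀ {D} → LeavesWithin 1 D → LeavesWithin m D
  LeavesWithin-backwards {zero}  leaves x = contradiction (proj₁ (proj₂ (leaves x))) λ ()
  LeavesWithin-backwards {suc D} leaves x with leaves (x ⊕ (D * m))
  ... | i , i<1+D , ¬Si = D ∸ i , s≤s (m∸n≤m D i) , subst (¬_ ∘ S) same ¬Si
    where
      open ≡-Reasoning
      rearrange : ∀ i e m → (i + e) * m + i * 1 ≡ e * m + i * suc m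
      rearrange = solve-∀
      same : (x ⊕ (D * m)) ⊕ (i * 1) ≡ x ⊕ ((D ∸ i) * m)
      same = begin
        (x ⊕ (D * m)) ⊕ (i * 1)             ≡⟨ ⊕-⊕ x (D * m) (i * 1) ⟩
        x ⊕ (D * m + i * 1)                 ≡⟨ cong (λ D → x ⊕ (D * m + i * 1)) (m+[n∸m]≡n (s≤s⁻¹ i<1+D)) ⟨
        x ⊕ ((i + (D ∸ i)) * m + i * 1)     ≡⟨ cong (x ⊕_) (rearrange i (D ∸ i) m) ⟩
        x ⊕ ((D ∸ i) * m + i * suc m)       ≡⟨ ⊕-+* x ((D ∸ i) * m) i ⟩
        x ⊕ ((D ∸ i) * m)                   ∎

  InducedEdge : Fin (suc m) → Fin (suc m) → Set
  InducedEdge u w = S u × S w × CycleAdj (suc m) u w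

  Arcs : Fin (suc m) → Fin (suc m) → Set
  Arcs v u = Arc 1 v u ⊎ Arc m v u

  Arcs-step : ∀ {v w w'} → Arcs v w → InducedEdge w w' → Arcs v w'
  Arcs-step (inj₁ arc) (_ , Sw' , w~w') = arc-step refl arc Sw' (CycleAdj⇒⊕ w~w')
  Arcs-step (inj₂ arc) (_ , Sw' , w~w') = swap (arc-step (+-comm m 1) arc Sw' (swap (CycleAdj⇒⊕ w~w')))

  Star⇒Arcs : ∀ {v w u} → Arcs v w → Star InducedEdge w u → Arcs v u
  Star⇒Arcs arcs ε         = arcs
  Star⇒Arcs arcs (e ◅ path) = Star⇒Arcs (Arcs-step arcs e) path

  Arc-within : ∀ {d D v u} → LeavesWithin d D → Arc d v u → u ∈ List.map (λ i → v ⊕ (i * d)) (upTo D)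
  Arc-within {d} {D} {v} leaves (k , refl , inS) with leaves v
  ... | i , i<D , ¬Si = ∈-map⁺ (λ i → v ⊕ (i * d)) (∈-upTo⁺ (<-trans (≰⇒> (¬Si ∘ inS i)) i<D))

  component-bounded : ∀ {D} → LeavesWithin 1 D → ∀ v → S v → ∀ L → Unique L →
                      All (Star InducedEdge v) L → length L ≤ D + D
  component-bounded {D} leaves v Sv L L-unique paths =
    subst (length L ≤_) window-length
      (Unique-⊆⇒length≤ L-unique (λ u∈L → Arcs-within (Star⇒Arcs start (All.lookup paths u∈L))))
    where
      forward  = List.map (λ i → v ⊕ (i * 1)) (upTo D)
      backward = List.map (λ i → v ⊕ (i * m)) (upTo D)
      v⊕0≡v : v ⊕ 0 ≡ v
      v⊕0≡v = ⊕-reaches v v 0 refl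
      start : Arcs v v
      start = inj₁ (0 , sym v⊕0≡v , λ { _ z≤n → subst S (sym v⊕0≡v) Sv })
      Arcs-within : ∀ {u} → Arcs v u → u ∈ forward ++ backward
      Arcs-within (inj₁ arc) = ∈-++⁺ˡ (Arc-within leaves arc)
      Arcs-within (inj₂ arc) = ∈-++⁺ʳ forward (Arc-within (LeavesWithin-backwards leaves) arc)
      window-length : length (forward ++ backward) ≡ D + D
      window-length = trans (length-++ forward)
        (cong₂ _+_ (trans (length-map _ (upTo D)) (length-upTo D)) (trans (length-map _ (upTo D)) (length-upTo D)))

GapInEveryWindow : ∀ {n} → (Fin n → Set) → ℕ → ℕ → Set
GapInEveryWindow S B c = ∀ j → j < c → ∃ λ q → j * B ≤ toℕ q × toℕ q < j * B + B × ¬ S q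

window-containing : ∀ {B} → 0 < B → ∀ x → ∃ λ j → j * B ≤ x × x < j * B + B
window-containing {B} 0<B x = x / B , m/n*n≤m x B , (begin-strict
  x                  ≡⟨ m≡m%n+[m/n]*n x B ⟩
  x % B + x / B * B  <⟨ +-monoˡ-< (x / B * B) (m%n<n x B) ⟩
  B + x / B * B      ≡⟨ +-comm B _ ⟩
  x / B * B + B      ∎)
  where
    open ≤-Reasoning
    instance
      B≢0 : NonZero B
      B≢0 = >-nonZero 0<B

⊕-ahead : ∀ {m D} (x q : Fin (suc m)) → toℕ x ≤ toℕ q → toℕ q < toℕ x + D → ∃ λ i → i < D × x ⊕ (i * 1) ≡ q
⊕-ahead {D = D} x q x≤q q<x+D =
  toℕ q ∸ toℕ x , +-cancelˡ-< (toℕ x) _ _ (subst (_< toℕ x + D) (sym x+i≡q) q<x+D)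
  , ⊕-reaches x q 0 (trans (cong (toℕ x +_) (*-identityʳ _)) (trans x+i≡q (sym (+-identityʳ _))))
  where
    x+i≡q : toℕ x + (toℕ q ∸ toℕ x) ≡ toℕ q
    x+i≡q = m+[n∸m]≡n x≤q

⊕-around : ∀ {m D} (x q : Fin (suc m)) → suc m + toℕ q < toℕ x + D → ∃ λ i → i < D × x ⊕ (i * 1) ≡ q
⊕-around {m} {D} x q n+q<x+D =
  i , +-cancelˡ-< (toℕ x) _ _ (subst (_< toℕ x + D) (sym x+i≡n+q) n+q<x+D) , ⊕-reaches x q 1 (begin
    toℕ x + i * 1      ≡⟨ cong (toℕ x +_) (*-identityʳ i) ⟩
    toℕ x + i          ≡⟨ x+i≡n+q ⟩
    suc m + toℕ q      ≡⟨ +-comm (suc m) (toℕ q) ⟩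
    toℕ q + suc m      ≡⟨ cong (toℕ q +_) (+-identityʳ (suc m)) ⟨
    toℕ q + 1 * suc m  ∎)
  where
    open ≡-Reasoning
    i = (suc m ∸ toℕ x) + toℕ q
    x+i≡n+q : toℕ x + i ≡ suc m + toℕ q
    x+i≡n+q = trans (sym (+-assoc (toℕ x) _ (toℕ q))) (cong (_+ toℕ q) (m+[n∸m]≡n (<⇒≤ (toℕ<n x))))

GapInEveryWindow⇒LeavesWithin : ∀ {m B c r} (S : Fin (suc m) → Set) →
  suc m ≡ c * B + r → r < B → 0 < c → GapInEveryWindow S B c → LeavesWithin S 1 (B + B + B)
GapInEveryWindow⇒LeavesWithin {m} {B} {c} {r} S n≡cB+r r<B 0<c gaps x =
  gap-after (window-containing (≤-<-trans z≤n r<B) (toℕ x))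
  where
    open ≤-Reasoning
    window-end : ∀ {j} → j * B ≤ toℕ x → suc j * B + B ≤ toℕ x + (B + B)
    window-end {j} jB≤x = begin
      B + j * B + B       ≤⟨ +-monoˡ-≤ B (+-monoʳ-≤ B jB≤x) ⟩
      B + toℕ x + B       ≡⟨ cong (_+ B) (+-comm B (toℕ x)) ⟩
      toℕ x + B + B       ≡⟨ +-assoc (toℕ x) B B ⟩
      toℕ x + (B + B)     ∎
    avoiding : ∀ {q} → ¬ S q → (∃ λ i → i < B + B + B × x ⊕ (i * 1) ≡ q) →
               ∃ λ i → i < B + B + B × ¬ S (x ⊕ (i * 1))
    avoiding ¬Sq (i , i<3B , x⊕i≡q) = i , i<3B , subst (¬_ ∘ S) (sym x⊕i≡q) ¬Sq
    gap-after : (∃ λ j → j * B ≤ toℕ x × toℕ x < j * B + B) → ∃ λ i → i < B + B + B × ¬ S (x ⊕ (i * 1))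
    gap-after (j , jB≤x , x<jB+B) with suc j <? c
    ... | yes 1+j<c with gaps (suc j) 1+j<c
    ...   | q , 1+j≤q , q<end , ¬Sq = avoiding ¬Sq (⊕-ahead x q x≤q (begin-strict
      toℕ q                    <⟨ q<end ⟩
      suc j * B + B            ≤⟨ window-end {j} jB≤x ⟩
      toℕ x + (B + B)          ≤⟨ +-monoʳ-≤ (toℕ x) (m≤m+n (B + B) B) ⟩
      toℕ x + (B + B + B)      ∎))
      where
        x≤q : toℕ x ≤ toℕ q
        x≤q = <⇒≤ (<-≤-trans x<jB+B (≤-trans (≤-reflexive (+-comm (j * B) B)) 1+j≤q))
    gap-after (j , jB≤x , x<jB+B) | no 1+j≮c with gaps 0 0<c
    ...   | q , _ , q<B , ¬Sq = avoiding ¬Sq (⊕-around x q (begin-strict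
      suc m + toℕ q            <⟨ +-mono-< n<x+2B q<B ⟩
      toℕ x + (B + B) + B      ≡⟨ +-assoc (toℕ x) (B + B) B ⟩
      toℕ x + (B + B + B)      ∎))
      where
        n<x+2B : suc m < toℕ x + (B + B)
        n<x+2B = begin-strict
          suc m           ≡⟨ n≡cB+r ⟩
          c * B + r       <⟨ +-monoʳ-< (c * B) r<B ⟩
          c * B + B       ≤⟨ +-monoˡ-≤ B (*-monoˡ-≤ B (≮⇒≥ 1+j≮c)) ⟩
          suc j * B + B   ≤⟨ window-end {j} jB≤x ⟩
          toℕ x + (B + B) ∎

Unique⇒length≤ : ∀ {n} {L : List (Fin n)} → Unique L → length L ≤ n
Unique⇒length≤ {n} {L} L-unique =
  subst (length L ≤_) (length-allFin n) (Unique-⊆⇒length≤ L-unique (λ {x} _ → ∈-allFin x))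

GapInEveryWindow⇒ComponentsBounded : ∀ {m B c r} (σ : Vec (Fin (suc m)) (suc m)) →
  suc m ≡ c * B + r → r < B → GapInEveryWindow (InT2 (suc m) σ) B c →
  ComponentsBounded (suc m) σ ((B + B + B) + (B + B + B))
GapInEveryWindow⇒ComponentsBounded {m} {B} {zero} {r} σ n≡r r<B _ _ _ L L-unique _ = begin
  length L                  ≤⟨ Unique⇒length≤ L-unique ⟩
  suc m                     ≡⟨ n≡r ⟩
  r                         ≤⟨ <⇒≤ r<B ⟩
  B                         ≤⟨ m≤m+n B (B + B) ⟩
  B + (B + B)               ≡⟨ +-assoc B B B ⟨
  B + B + B                 ≤⟨ m≤m+n _ _ ⟩
  (B + B + B) + (B + B + B) ∎
  where open ≤-Reasoning
GapInEveryWindow⇒ComponentsBounded {c = suc _} σ n≡cB+r r<B gaps =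
  component-bounded (InT2 _ σ) (GapInEveryWindow⇒LeavesWithin (InT2 _ σ) n≡cB+r r<B z<s gaps)

-- Union bounds

union-bound-step : ∀ {g b a G A c E F} → g + b ≡ a → E * b ≤ F * a →
                   E * A ≤ E * G + c * (F * A) →
                   E * (a * A) ≤ E * (g * G) + suc c * (F * (a * A))
union-bound-step {g} {b} {a} {G} {A} {c} {E} {F} refl Eb≤Fa EA≤EG+cFA = begin
  E * (a * A)                                     ≡⟨ x∙yz≈y∙xz E a A ⟩
  a * (E * A)                                     ≡⟨ *-distribʳ-+ (E * A) g b ⟩
  g * (E * A) + b * (E * A)                       ≤⟨ +-mono-≤ good-part bad-part ⟩
  E * (g * G) + c * (F * (a * A)) + F * (a * A)   ≡⟨ +-assoc (E * (g * G)) _ _ ⟩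
  E * (g * G) + (c * (F * (a * A)) + F * (a * A)) ≡⟨ cong (E * (g * G) +_) (+-comm _ (F * (a * A))) ⟩
  E * (g * G) + suc c * (F * (a * A))             ∎
  where
    open ≤-Reasoning
    good-part : g * (E * A) ≤ E * (g * G) + c * (F * (a * A))
    good-part = begin
      g * (E * A)                       ≤⟨ *-monoʳ-≤ g EA≤EG+cFA ⟩
      g * (E * G + c * (F * A))         ≡⟨ *-distribˡ-+ g (E * G) _ ⟩
      g * (E * G) + g * (c * (F * A))   ≡⟨ cong₂ _+_ (x∙yz≈y∙xz g E G)
                                             (trans (x∙yz≈y∙xz g c _) (cong (c *_) (x∙yz≈y∙xz g F A))) ⟩
      E * (g * G) + c * (F * (g * A))   ≤⟨ +-monoʳ-≤ (E * (g * G))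
                                             (*-monoʳ-≤ c (*-monoʳ-≤ F (*-monoˡ-≤ A (m≤m+n g b)))) ⟩
      E * (g * G) + c * (F * (a * A))   ∎
    bad-part : b * (E * A) ≤ F * (a * A)
    bad-part = begin
      b * (E * A)   ≡⟨ sym (*-assoc b E A) ⟩
      b * E * A     ≡⟨ cong (_* A) (*-comm b E) ⟩
      E * b * A     ≤⟨ *-monoˡ-≤ A Eb≤Fa ⟩
      F * a * A     ≡⟨ *-assoc F a A ⟩
      F * (a * A)   ∎

module _ (pos step : ℕ → ℕ) where

  ∏-union-bound : ∀ {E F} (L G B : ∀ k → List (Code (pos k) (pos (step k)))) →
    (∀ k → length (G k) + length (B k) ≡ length (L k)) →
    (∀ k → E * length (B k) ≤ F * length (L k)) →
    ∀ k c → E * length (∏ pos step L k c) ≤ E * length (∏ pos step G k c) + c * (F * length (∏ pos step L k c))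
  ∏-union-bound L G B partition rare k zero = m≤m+n _ 0
  ∏-union-bound {E} {F} L G B partition rare k (suc c) =
    subst₂ (λ l g → E * l ≤ E * g + suc c * (F * l))
      (sym (length-⊗ (L k) (∏ pos step L (step k) c))) (sym (length-⊗ (G k) (∏ pos step G (step k) c)))
      (union-bound-step {c = c} {E} {F} (partition k) (rare k) (∏-union-bound {E} {F} L G B partition rare (step k) c))

union-bound-scale : ∀ {E F A G c} R → E * A ≤ E * G + c * (F * A) →
                    E * (A * R) ≤ E * (G * R) + c * (F * (A * R))
union-bound-scale {E} {F} {A} {G} {c} R bound = begin
  E * (A * R)                   ≡⟨ *-assoc E A R ⟨
  E * A * R                     ≤⟨ *-monoˡ-≤ R bound ⟩
  (E * G + c * (F * A)) * R     ≡⟨ *-distribʳ-+ R (E * G) _ ⟩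
  E * G * R + c * (F * A) * R   ≡⟨ cong₂ _+_ (*-assoc E G R) (trans (*-assoc c (F * A) R) (cong (c *_) (*-assoc F A R))) ⟩
  E * (G * R) + c * (F * (A * R)) ∎
  where open ≤-Reasoning

union-bound⇒fraction : ∀ {E F N O c M} → 0 < E → suc M * (c * F) ≤ E →
                       E * N ≤ E * O + c * (F * N) → M * N ≤ suc M * O
union-bound⇒fraction {E} {F} {N} {O} {c} {M} 0<E rare bound =
  +-cancelˡ-≤ N _ _ (≤-trans scaled (≤-reflexive (+-comm (suc M * O) N)))
  where
    open ≤-Reasoning
    instance
      E≢0 : NonZero E
      E≢0 = >-nonZero 0<E
    scaled : suc M * N ≤ suc M * O + N
    scaled = *-cancelˡ-≤ E (begin
      E * (suc M * N)                               ≡⟨ x∙yz≈y∙xz E (suc M) N ⟩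
      suc M * (E * N)                               ≤⟨ *-monoʳ-≤ (suc M) bound ⟩
      suc M * (E * O + c * (F * N))                 ≡⟨ *-distribˡ-+ (suc M) (E * O) _ ⟩
      suc M * (E * O) + suc M * (c * (F * N))       ≡⟨ cong₂ _+_ (x∙yz≈y∙xz (suc M) E O)
                                                         (trans (cong (suc M *_) (sym (*-assoc c F N))) (sym (*-assoc (suc M) (c * F) N))) ⟩
      E * (suc M * O) + suc M * (c * F) * N         ≤⟨ +-monoʳ-≤ (E * (suc M * O)) (*-monoˡ-≤ N rare) ⟩
      E * (suc M * O) + E * N                       ≡⟨ *-distribˡ-+ E (suc M * O) N ⟨
      E * (suc M * O + N)                           ∎)

-- Units of four vertices and blocks of units

below : ∀ {n} h → h ≤ n → List (Fin n)
below h h≤n = List.map (λ i → inject≤ i h≤n) (allFin h)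

above : ∀ {n} h l → h + l ≡ n → List (Fin n)
above h l h+l≡n = List.map (λ i → cast h+l≡n (h ↑ʳ i)) (allFin l)

length-below : ∀ {n} h (h≤n : h ≤ n) → length (below h h≤n) ≡ h
length-below h h≤n = trans (length-map _ (allFin h)) (length-allFin h)

length-above : ∀ {n} h l (h+l≡n : h + l ≡ n) → length (above h l h+l≡n) ≡ l
length-above h l h+l≡n = trans (length-map _ (allFin l)) (length-allFin l)

below-unique : ∀ {n} h (h≤n : h ≤ n) → Unique (below h h≤n)
below-unique h h≤n = Unique.map⁺ (inject≤-injective h≤n h≤n _ _) (Unique.allFin⁺ h)

above-unique : ∀ {n} h l (h+l≡n : h + l ≡ n) → Unique (above h l h+l≡n)
above-unique h l h+l≡n = Unique.map⁺ cast-↑ʳ-injective (Unique.allFin⁺ l)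
  where
    cast-↑ʳ-injective : ∀ {i j} → cast h+l≡n (h ↑ʳ i) ≡ cast h+l≡n (h ↑ʳ j) → i ≡ j
    cast-↑ʳ-injective {i} {j} eq = ↑ʳ-injective h i j
      (toℕ-injective (trans (sym (toℕ-cast h+l≡n _)) (trans (cong toℕ eq) (toℕ-cast h+l≡n _))))

∈-below⇒< : ∀ {n h} (h≤n : h ≤ n) {c} → c ∈ below h h≤n → toℕ c < h
∈-below⇒< h≤n c∈ with ∈-map⁻ _ c∈
... | i , _ , refl = subst (_< _) (sym (toℕ-inject≤ i h≤n)) (toℕ<n i)

∈-above⇒≥ : ∀ {n h l} (h+l≡n : h + l ≡ n) {c} → c ∈ above h l h+l≡n → h ≤ toℕ c
∈-above⇒≥ {h = h} h+l≡n c∈ with ∈-map⁻ _ c∈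
... | i , _ , refl = subst (h ≤_) (sym (trans (toℕ-cast h+l≡n _) (toℕ-↑ʳ h i))) (m≤m+n h (toℕ i))

Succeeds : ∀ {a b} → ℕ → Code a b → Set
Succeeds h done               = ⊥
Succeeds h (_ ∷ done)         = ⊥
Succeeds h (_ ∷ _ ∷ done)     = ⊥
Succeeds h (c₀ ∷ c₁ ∷ c₂ ∷ _) = toℕ c₀ < h × h ≤ toℕ c₁ × toℕ c₂ < h

Succeeds? : ∀ {a b} h → Decidable (Succeeds {a} {b} h)
Succeeds? h done               = no λ ()
Succeeds? h (_ ∷ done)         = no λ ()
Succeeds? h (_ ∷ _ ∷ done)     = no λ ()
Succeeds? h (c₀ ∷ c₁ ∷ c₂ ∷ _) = (toℕ c₀ <? h) ×-dec (h ≤? toℕ c₁) ×-dec (toℕ c₂ <? h)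

Succeeds⇒PeakIn : ∀ {a b h} (x : Code a b) → Succeeds h x → PeakIn a b x
Succeeds⇒PeakIn (c₀ ∷ c₁ ∷ c₂ ∷ rest) (c₀<h , h≤c₁ , c₂<h) = record
  { before = done ; c₀ = c₀ ; c₁ = c₁ ; c₂ = c₂ ; after = rest ; split = refl
  ; rises = <-≤-trans c₀<h h≤c₁ ; falls = <⇒≤ (<-≤-trans c₂<h h≤c₁)
  ; lo≤p = ≤-refl ; p+3≤hi = Code-≤ rest
  }

opaque
  unitCodes : ∀ k → List (Code (k * 4) (suc k * 4))
  unitCodes k = codes 4 refl

  unitCodes-unique : ∀ k → Unique (unitCodes k)
  unitCodes-unique k = codes-unique 4 refl

  unitCodes-complete : ∀ k x → x ∈ unitCodes k
  unitCodes-complete k = codes-complete 4 refl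

  unitCodes-FullSize : ∀ k → FullSize (unitCodes k)
  unitCodes-FullSize k = codes-FullSize {k * 4} 4 refl

threshold : ℕ → ℕ
threshold k = suc (k * 2)

successes failures : ∀ k → List (Code (k * 4) (suc k * 4))
successes k = filter (Succeeds? (threshold k)) (unitCodes k)
failures  k = filter (¬? ∘ Succeeds? (threshold k)) (unitCodes k)

threshold≤1+4k : ∀ k → threshold k ≤ 1 + k * 4
threshold≤1+4k k = s≤s (*-monoʳ-≤ k (s≤s (s≤s z≤n)))

threshold≤3+4k : ∀ k → threshold k ≤ 3 + k * 4
threshold≤3+4k k = ≤-trans (threshold≤1+4k k) (m≤n+m _ 2)

threshold+threshold : ∀ k → threshold k + threshold k ≡ 2 + k * 4
threshold+threshold k = cong suc (trans (+-suc (k * 2) (k * 2)) (cong suc (sym (*-distribˡ-+ k 2 2))))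

witnesses : ∀ k → List (Code (k * 4) (suc k * 4))
witnesses k = below h (threshold≤1+4k k) ⊛ (above h h (threshold+threshold k) ⊛
  (below h (threshold≤3+4k k) ⊛ (allFin (4 + k * 4) ⊛ (done ∷ []))))
  where h = threshold k

length-witnesses : ∀ k → let h = threshold k in
  length (witnesses k) ≡ h * (h * (h * ((4 + k * 4) * 1)))
length-witnesses k =
  trans (length-⊛ l₀ (l₁ ⊛ (l₂ ⊛ l₃))) (cong₂ _*_ (length-below h h≤1+a)
  (trans (length-⊛ l₁ (l₂ ⊛ l₃)) (cong₂ _*_ (length-above h h h+h≡2+a)
  (trans (length-⊛ l₂ l₃) (cong₂ _*_ (length-below h h≤3+a)
  (trans (length-⊛ (allFin (4 + k * 4)) (done ∷ [])) (cong (_* 1) (length-allFin (4 + k * 4)))))))))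
  where
    h = threshold k
    h≤1+a = threshold≤1+4k k
    h≤3+a = threshold≤3+4k k
    h+h≡2+a = threshold+threshold k
    l₀ = below h h≤1+a
    l₁ = above h h h+h≡2+a
    l₂ = below h h≤3+a
    l₃ = allFin (4 + k * 4) ⊛ (done ∷ [])

witnesses-unique : ∀ k → Unique (witnesses k)
witnesses-unique k =
  ⊛-unique (below-unique h (threshold≤1+4k k)) (⊛-unique (above-unique h h (threshold+threshold k))
  (⊛-unique (below-unique h (threshold≤3+4k k)) (⊛-unique (Unique.allFin⁺ (4 + k * 4)) ([] ∷ []))))
  where h = threshold k

⊛³-Succeeds : ∀ {a b h} (r₀s : List (Fin (suc a))) (r₁s : List (Fin (2 + a))) (r₂s : List (Fin (3 + a)))
  (xs : List (Code (3 + a) b)) → (∀ {c} → c ∈ r₀s → toℕ c < h) → (∀ {c} → c ∈ r₁s → h ≤ toℕ c) →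
  (∀ {c} → c ∈ r₂s → toℕ c < h) → ∀ {x} → x ∈ r₀s ⊛ (r₁s ⊛ (r₂s ⊛ xs)) → Succeeds h x
⊛³-Succeeds r₀s r₁s r₂s xs low₀ high₁ low₂ x∈ with ∈-cartesianProductWith⁻ _∷_ r₀s _ x∈
... | c₀ , y , c₀∈ , y∈ , refl with ∈-cartesianProductWith⁻ _∷_ r₁s _ y∈
... | c₁ , z , c₁∈ , z∈ , refl with ∈-cartesianProductWith⁻ _∷_ r₂s xs z∈
... | c₂ , _ , c₂∈ , _  , refl = low₀ c₀∈ , high₁ c₁∈ , low₂ c₂∈

witnesses⊆successes : ∀ k → witnesses k ⊆ successes k
witnesses⊆successes k {x} x∈ = ∈-filter⁺ (Succeeds? h) (unitCodes-complete k x)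
  (⊛³-Succeeds (below h h≤1+a) (above h h h+h≡2+a) (below h h≤3+a) (allFin (4 + k * 4) ⊛ (done ∷ []))
    (∈-below⇒< h≤1+a) (∈-above⇒≥ h+h≡2+a) (∈-below⇒< h≤3+a) x∈)
  where
    h = threshold k
    h≤1+a = threshold≤1+4k k
    h≤3+a = threshold≤3+4k k
    h+h≡2+a = threshold+threshold k

length-unitCodes : ∀ k → let a = k * 4 in
  length (unitCodes k) ≡ (1 + a) * ((2 + a) * ((3 + a) * ((4 + a) * 1)))
length-unitCodes k = *-cancelˡ-≡ _ _ ((k * 4) !) {{(k * 4) !≢0}}
  (trans (unitCodes-FullSize k) (falling (k * 4) ((k * 4) !)))
  where
    falling : ∀ a f → (4 + a) * ((3 + a) * ((2 + a) * ((1 + a) * f)))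
                      ≡ f * ((1 + a) * ((2 + a) * ((3 + a) * ((4 + a) * 1))))
    falling = solve-∀

-- 8 h³ (a + 4) = (a + 1)(a + 2)(a + 3)(a + 4) + (a + 2)(a + 4) for h = 2k + 1 and a = 4k
successes-dense : ∀ k → length (unitCodes k) ≤ 8 * length (successes k)
successes-dense k = begin
  length (unitCodes k)                         ≡⟨ length-unitCodes k ⟩
  (1 + a) * ((2 + a) * ((3 + a) * ((4 + a) * 1))) ≤⟨ m≤m+n _ ((2 + a) * (4 + a)) ⟩
  (1 + a) * ((2 + a) * ((3 + a) * ((4 + a) * 1))) + (2 + a) * (4 + a) ≡⟨ cube k ⟩
  8 * (h * (h * (h * ((4 + a) * 1))))          ≡⟨ cong (8 *_) (length-witnesses k) ⟨
  8 * length (witnesses k)                     ≤⟨ *-monoʳ-≤ 8 (Unique-⊆⇒length≤ (witnesses-unique k)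
                                                    (witnesses⊆successes k)) ⟩
  8 * length (successes k)                     ∎
  where
    open ≤-Reasoning
    a = k * 4
    h = threshold k
    cube : ∀ k → (1 + k * 4) * ((2 + k * 4) * ((3 + k * 4) * ((4 + k * 4) * 1))) + (2 + k * 4) * (4 + k * 4)
                 ≡ 8 * (suc (k * 2) * (suc (k * 2) * (suc (k * 2) * ((4 + k * 4) * 1))))
    cube = solve-∀

complement-≤ : ∀ {s f u d} → s + f ≡ u → u ≤ suc d * s → suc d * f ≤ d * u
complement-≤ {s} {f} {_} {d} refl u≤ = +-cancelʳ-≤ (s + f) _ _ (begin
  suc d * f + (s + f)       ≤⟨ +-monoʳ-≤ (suc d * f) u≤ ⟩
  suc d * f + suc d * s     ≡⟨ *-distribˡ-+ (suc d) f s ⟨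
  suc d * (f + s)           ≡⟨ cong (suc d *_) (+-comm f s) ⟩
  (s + f) + d * (s + f)     ≡⟨ +-comm (s + f) _ ⟩
  d * (s + f) + (s + f)     ∎)
  where open ≤-Reasoning

unit-partition : ∀ k → length (successes k) + length (failures k) ≡ length (unitCodes k)
unit-partition k = length-filter+length-filter-¬ (Succeeds? (threshold k)) (unitCodes k)

failures-rare : ∀ k → 8 * length (failures k) ≤ 7 * length (unitCodes k)
failures-rare k = complement-≤ {length (successes k)} {length (failures k)} {d = 7} (unit-partition k) (successes-dense k)

blockCodes failedBlocks : ∀ k t → List (Code (k * 4) (iterate suc k t * 4))
blockCodes   = ∏ (_* 4) suc unitCodes
failedBlocks = ∏ (_* 4) suc failures

goodBlocks : ∀ k t → List (Code (k * 4) (iterate suc k t * 4))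
goodBlocks k zero    = []
goodBlocks k (suc t) = successes k ⊗ blockCodes (suc k) t ++ failures k ⊗ goodBlocks (suc k) t

block-partition : ∀ k t → length (goodBlocks k t) + length (failedBlocks k t) ≡ length (blockCodes k t)
block-partition k zero    = refl
block-partition k (suc t) = begin
  length (successes k ⊗ blockCodes (suc k) t ++ failures k ⊗ goodBlocks (suc k) t)
    + length (failures k ⊗ failedBlocks (suc k) t)
    ≡⟨ cong₂ _+_ (trans (length-++ (successes k ⊗ blockCodes (suc k) t))
                         (cong₂ _+_ (length-⊗ (successes k) (blockCodes (suc k) t)) (length-⊗ (failures k) (goodBlocks (suc k) t))))
                 (length-⊗ (failures k) (failedBlocks (suc k) t)) ⟩
  s * a + f * g + f * b    ≡⟨ +-assoc (s * a) _ _ ⟩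
  s * a + (f * g + f * b)  ≡⟨ cong (s * a +_) (*-distribˡ-+ f g b) ⟨
  s * a + f * (g + b)      ≡⟨ cong (λ l → s * a + f * l) (block-partition (suc k) t) ⟩
  s * a + f * a            ≡⟨ *-distribʳ-+ a s f ⟨
  (s + f) * a              ≡⟨ cong (_* a) (unit-partition k) ⟩
  length (unitCodes k) * a ≡⟨ length-⊗ (unitCodes k) (blockCodes (suc k) t) ⟨
  length (blockCodes k (suc t)) ∎
  where
    open ≡-Reasoning
    s = length (successes k)
    f = length (failures k)
    a = length (blockCodes (suc k) t)
    g = length (goodBlocks (suc k) t)
    b = length (failedBlocks (suc k) t)

failedBlocks-rare : ∀ k t → 8 ^ t * length (failedBlocks k t) ≤ 7 ^ t * length (blockCodes k t)
failedBlocks-rare k zero    = ≤-refl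
failedBlocks-rare k (suc t) = begin
  8 * 8 ^ t * length (failures k ⊗ failedBlocks (suc k) t)   ≡⟨ cong (8 * 8 ^ t *_) (length-⊗ (failures k) (failedBlocks (suc k) t)) ⟩
  8 * 8 ^ t * (length (failures k) * length (failedBlocks (suc k) t))
    ≡⟨ interchange 8 (8 ^ t) (length (failures k)) (length (failedBlocks (suc k) t)) ⟩
  8 * length (failures k) * (8 ^ t * length (failedBlocks (suc k) t))
    ≤⟨ *-mono-≤ (failures-rare k) (failedBlocks-rare (suc k) t) ⟩
  7 * length (unitCodes k) * (7 ^ t * length (blockCodes (suc k) t))
    ≡⟨ interchange 7 (length (unitCodes k)) (7 ^ t) (length (blockCodes (suc k) t)) ⟩
  7 * 7 ^ t * (length (unitCodes k) * length (blockCodes (suc k) t))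
    ≡⟨ cong (7 * 7 ^ t *_) (length-⊗ (unitCodes k) (blockCodes (suc k) t)) ⟨
  7 * 7 ^ t * length (blockCodes k (suc t))                  ∎
  where open ≤-Reasoning

successes-unique : ∀ k → Unique (successes k)
successes-unique k = Unique.filter⁺ (Succeeds? (threshold k)) (unitCodes-unique k)

failures-unique : ∀ k → Unique (failures k)
failures-unique k = Unique.filter⁺ (¬? ∘ Succeeds? (threshold k)) (unitCodes-unique k)

blockCodes-unique : ∀ k t → Unique (blockCodes k t)
blockCodes-unique = ∏-unique (_* 4) suc unitCodes-unique

goodBlocks-unique : ∀ k t → Unique (goodBlocks k t)
goodBlocks-unique k zero    = []
goodBlocks-unique k (suc t) = Unique.++⁺
  (⊗-unique (successes-unique k) (blockCodes-unique (suc k) t))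
  (⊗-unique (failures-unique k) (goodBlocks-unique (suc k) t))
  disjoint
  where
    h = threshold k
    disjoint : ∀ {X} → ¬ (X ∈ successes k ⊗ blockCodes (suc k) t × X ∈ failures k ⊗ goodBlocks (suc k) t)
    disjoint (X∈₁ , X∈₂)
      with ∈-cartesianProductWith⁻ _++ᶜ_ (successes k) (blockCodes (suc k) t) X∈₁
         | ∈-cartesianProductWith⁻ _++ᶜ_ (failures k) (goodBlocks (suc k) t) X∈₂
    ... | x , _ , x∈ , _ , refl | x' , _ , x'∈ , _ , eq with ++ᶜ-injective x x' eq
    ...   | refl , _ = proj₂ (∈-filter⁻ (¬? ∘ Succeeds? h) {xs = unitCodes k} x'∈)
                             (proj₂ (∈-filter⁻ (Succeeds? h) {xs = unitCodes k} x∈))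

goodBlocks-PeakIn : ∀ k t → All (PeakIn (k * 4) (iterate suc k t * 4)) (goodBlocks k t)
goodBlocks-PeakIn k zero    = []
goodBlocks-PeakIn k (suc t) = All.++⁺
  (All.cartesianProductWith⁺ (setoid _) (setoid _) _++ᶜ_ (successes k) (blockCodes (suc k) t)
    λ {x} {y} x∈ _ → PeakIn-widen ≤-refl (Code-≤ y)
      (PeakIn-++ᶜʳ (Succeeds⇒PeakIn x (proj₂ (∈-filter⁻ (Succeeds? h) {xs = unitCodes k} x∈))) y))
  (All.cartesianProductWith⁺ (setoid _) (setoid _) _++ᶜ_ (failures k) (goodBlocks (suc k) t)
    λ {x} _ y∈ → PeakIn-widen (Code-≤ x) ≤-refl (PeakIn-++ᶜˡ x (All.lookup (goodBlocks-PeakIn (suc k) t) y∈)))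
  where h = threshold k

iterate-suc : ∀ k t → iterate suc k t ≡ t + k
iterate-suc k t = trans (sym (iterate-is-fold k suc t)) (+-is-fold t)

module Chain (t : ℕ) where

  step : ℕ → ℕ
  step k = iterate suc k t

  start : ℕ → ℕ
  start = iterate step 0

  start-closed : ∀ j → start j * 4 ≡ j * (t * 4)
  start-closed j = trans (cong (_* 4) (from j 0)) (trans (cong (_* 4) (+-identityʳ (j * t))) (*-assoc j t 4))
    where
      from : ∀ j k → iterate step k j ≡ j * t + k
      from zero    k = refl
      from (suc j) k = begin
        iterate step (step k) j  ≡⟨ from j (step k) ⟩
        j * t + step k           ≡⟨ cong (j * t +_) (iterate-suc k t) ⟩
        j * t + (t + k)          ≡⟨ +-assoc (j * t) t k ⟨
        j * t + t + k            ≡⟨ cong (_+ k) (+-comm (j * t) t) ⟩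
        suc j * t + k            ∎
        where open ≡-Reasoning

  chainCodes goodChains : ∀ c → List (Code 0 (start c * 4))
  chainCodes = ∏ (_* 4) step (λ k → blockCodes k t) 0
  goodChains = ∏ (_* 4) step (λ k → goodBlocks k t) 0

  chainCodes-FullSize : ∀ c → FullSize (chainCodes c)
  chainCodes-FullSize = ∏-FullSize (_* 4) step (λ k → ∏-FullSize (_* 4) suc unitCodes-FullSize k t) 0

  goodChains-unique : ∀ c → Unique (goodChains c)
  goodChains-unique = ∏-unique (_* 4) step (λ k → goodBlocks-unique k t) 0

  chain-union-bound : ∀ c → 8 ^ t * length (chainCodes c) ≤ 8 ^ t * length (goodChains c) + c * (7 ^ t * length (chainCodes c))
  chain-union-bound = ∏-union-bound (_* 4) step {8 ^ t} {7 ^ t} (λ k → blockCodes k t) (λ k → goodBlocks k t) (λ k → failedBlocks k t)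
    (λ k → block-partition k t) (λ k → failedBlocks-rare k t) 0

  goodChains-gaps : ∀ {m c} {Y : Code 0 (start c * 4)} → Y ∈ goodChains c → (z : Code (start c * 4) (suc m)) →
                    GapInEveryWindow (InT2 (suc m) (decode (Y ++ᶜ z))) (t * 4) c
  goodChains-gaps {m} {c} {Y} Y∈ z j j<c = window-gap (PeakIn-¬InT2 peak)
    where
      peak : PeakIn (start j * 4) (start (suc j) * 4) (Y ++ᶜ z)
      peak = PeakIn-++ᶜʳ (All.lookup (∏-PeakIn (_* 4) step {λ k → goodBlocks k t} (λ k → goodBlocks-PeakIn k t) 0 c) Y∈ j j<c) z
      window-gap : ∀ {P : Fin (suc m) → Set} → (∃ λ q → start j * 4 ≤ toℕ q × toℕ q < start (suc j) * 4 × P q) →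
                   ∃ λ q → j * (t * 4) ≤ toℕ q × toℕ q < j * (t * 4) + t * 4 × P q
      window-gap (q , lo≤q , q<hi , Pq) =
        q , subst (_≤ toℕ q) (start-closed j) lo≤q
          , subst (toℕ q <_) (trans (start-closed (suc j)) (+-comm (t * 4) (j * (t * 4)))) q<hi , Pq

-- c blocks of 4t vertices, each with a peak, followed by r unconstrained vertices
peaked-orderings : ∀ {m t c r} → suc m ≡ c * (t * 4) + r → r < t * 4 →
  ∃ λ (L : List (Vec (Fin (suc m)) (suc m))) → Unique L ×
    All (λ σ → IsOrdering (suc m) σ × ComponentsBounded (suc m) σ ((t * 4 + t * 4 + t * 4) + (t * 4 + t * 4 + t * 4))) L ×
    8 ^ t * suc m ! ≤ 8 ^ t * length L + c * (7 ^ t * suc m !)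
peaked-orderings {m} {t} {c} {r} n≡cB+r r<B = List.map decode orderingCodes , unique , good , count
  where
    open Chain t
    B = t * 4
    tail-fits : r + start c * 4 ≡ suc m
    tail-fits = trans (cong (r +_) (start-closed c)) (trans (+-comm r _) (sym n≡cB+r))
    tails : List (Code (start c * 4) (suc m))
    tails = codes r tail-fits
    orderingCodes : List (Code 0 (suc m))
    orderingCodes = goodChains c ⊗ tails
    unique : Unique (List.map decode orderingCodes)
    unique = Unique.map⁺ decode-injective (⊗-unique (goodChains-unique c) (codes-unique r tail-fits))
    good : All (λ σ → IsOrdering (suc m) σ × ComponentsBounded (suc m) σ ((B + B + B) + (B + B + B)))
               (List.map decode orderingCodes)
    good = All.map⁺ (All.cartesianProductWith⁺ (setoid _) (setoid _) _++ᶜ_ (goodChains c) tails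
      λ {Y} {z} Y∈ _ → decode-IsOrdering (Y ++ᶜ z)
                     , GapInEveryWindow⇒ComponentsBounded (decode (Y ++ᶜ z)) n≡cB+r r<B (goodChains-gaps {c = c} Y∈ z))
    all-orderings : length (chainCodes c ⊗ tails) ≡ suc m !
    all-orderings = trans (sym (+-identityʳ _))
      (⊗-FullSize (chainCodes c) tails (chainCodes-FullSize c) (codes-FullSize r tail-fits))
    count : 8 ^ t * suc m ! ≤ 8 ^ t * length (List.map decode orderingCodes) + c * (7 ^ t * suc m !)
    count = subst₂ (λ N O → 8 ^ t * N ≤ 8 ^ t * O + c * (7 ^ t * N))
      (trans (sym (length-⊗ (chainCodes c) tails)) all-orderings)
      (sym (trans (length-map decode orderingCodes) (length-⊗ (goodChains c) tails)))
      (union-bound-scale {8 ^ t} {7 ^ t} {length (chainCodes c)} {length (goodChains c)} {c} (length tails)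
        (chain-union-bound c))

n<2^n : ∀ n → n < 2 ^ n
n<2^n zero    = z<s
n<2^n (suc n) = begin-strict
  suc n                   ≤⟨ n<2^n n ⟩
  2 ^ n                   <⟨ m<m+n (2 ^ n) (m^n>0 2 n) ⟩
  2 ^ n + 2 ^ n           ≡⟨ cong (2 ^ n +_) (+-identityʳ (2 ^ n)) ⟨
  2 ^ suc n               ∎
  where open ≤-Reasoning

n<2^[1+⌊log₂n⌋] : ∀ n → n < 2 ^ suc ⌊log₂ n ⌋
n<2^[1+⌊log₂n⌋] n = ≰⇒> λ 2^[1+ℓ]≤n →
  n≮n ⌊log₂ n ⌋ (subst (_≤ ⌊log₂ n ⌋) (⌊log₂[2^n]⌋≡n (suc ⌊log₂ n ⌋)) (⌊log₂⌋-mono-≤ 2^[1+ℓ]≤n))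

2^k≤n⇒k≤⌊log₂n⌋ : ∀ k {n} → 2 ^ k ≤ n → k ≤ ⌊log₂ n ⌋
2^k≤n⇒k≤⌊log₂n⌋ k 2^k≤n = subst (_≤ _) (⌊log₂[2^n]⌋≡n k) (⌊log₂⌋-mono-≤ 2^k≤n)

m*n≤o⇒m^k*n^k≤o^k : ∀ {m n o} k → m * n ≤ o → m ^ k * n ^ k ≤ o ^ k
m*n≤o⇒m^k*n^k≤o^k             zero    _      = ≤-refl
m*n≤o⇒m^k*n^k≤o^k {m} {n} {o} (suc k) mn≤o = begin
  m * m ^ k * (n * n ^ k)   ≡⟨ interchange m (m ^ k) n (n ^ k) ⟩
  m * n * (m ^ k * n ^ k)   ≤⟨ *-mono-≤ mn≤o (m*n≤o⇒m^k*n^k≤o^k k mn≤o) ⟩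
  o * o ^ k                 ∎
  where open ≤-Reasoning

-- (M + 1) c (7/8)^(12 ℓ) ≤ 1 because M + 1 ≤ 2^ℓ, c < 2^ℓ and 4 · 7¹² ≤ 8¹²
rare-failure : ∀ {M n c} → 2 ^ suc M ≤ n → c * (12 * ⌊log₂ n ⌋ * 4) ≤ n →
               suc M * (c * 7 ^ (12 * ⌊log₂ n ⌋)) ≤ 8 ^ (12 * ⌊log₂ n ⌋)
rare-failure {M} {n} {c} 2^[1+M]≤n cB≤n = begin
  suc M * (c * 7 ^ (12 * ℓ))          ≤⟨ *-mono-≤ 1+M≤2^ℓ (*-monoˡ-≤ _ (<⇒≤ c<2^ℓ)) ⟩
  2 ^ ℓ * (2 ^ ℓ * 7 ^ (12 * ℓ))      ≡⟨ *-assoc (2 ^ ℓ) (2 ^ ℓ) _ ⟨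
  2 ^ ℓ * 2 ^ ℓ * 7 ^ (12 * ℓ)        ≤⟨ *-monoˡ-≤ _ (m*n≤o⇒m^k*n^k≤o^k ℓ ≤-refl) ⟩
  4 ^ ℓ * 7 ^ (12 * ℓ)                ≡⟨ cong (4 ^ ℓ *_) (^-*-assoc 7 12 ℓ) ⟨
  4 ^ ℓ * (7 ^ 12) ^ ℓ                ≤⟨ m*n≤o⇒m^k*n^k≤o^k ℓ (≤ᵇ⇒≤ (4 * 7 ^ 12) (8 ^ 12) _) ⟩
  (8 ^ 12) ^ ℓ                        ≡⟨ ^-*-assoc 8 12 ℓ ⟩
  8 ^ (12 * ℓ)                        ∎
  where
    open ≤-Reasoning
    ℓ = ⌊log₂ n ⌋
    1+M≤ℓ : suc M ≤ ℓ
    1+M≤ℓ = 2^k≤n⇒k≤⌊log₂n⌋ (suc M) 2^[1+M]≤n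
    1+M≤2^ℓ : suc M ≤ 2 ^ ℓ
    1+M≤2^ℓ = ≤-trans (n<2^n M) (^-monoʳ-≤ 2 (<⇒≤ 1+M≤ℓ))
    2≤B : 2 ≤ 12 * ℓ * 4
    2≤B = ≤-trans (s≤s (s≤s z≤n)) (*-monoˡ-≤ 4 (*-monoʳ-≤ 12 (≤-trans (s≤s z≤n) 1+M≤ℓ)))
    c<2^ℓ : c < 2 ^ ℓ
    c<2^ℓ = *-cancelˡ-< 2 c (2 ^ ℓ) (begin-strict
      2 * c               ≡⟨ *-comm 2 c ⟩
      c * 2               ≤⟨ *-monoʳ-≤ c 2≤B ⟩
      c * (12 * ℓ * 4)    ≤⟨ cB≤n ⟩
      n                   <⟨ n<2^[1+⌊log₂n⌋] n ⟩
      2 * 2 ^ ℓ           ∎)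

most-orderings-good : ∀ M n → 2 ^ suc M ≤ n →
  ∃ λ (L : List (Vec (Fin n) n)) → Unique L × All (Good 288 n) L × M * n ! ≤ suc M * length L
most-orderings-good M zero    2^[1+M]≤0 = contradiction 2^[1+M]≤0 (<⇒≱ (m^n>0 2 (suc M)))
most-orderings-good M (suc m) 2^[1+M]≤n =
  let L , L-unique , L-good , L-count = peaked-orderings {m} {t} {n / B} {n % B} n≡cB+r (m%n<n n B)
  in  L , L-unique , All.map (λ {σ} → map₂ (subst (ComponentsBounded n σ) (six-blocks ℓ))) L-good
        , union-bound⇒fraction {8 ^ t} {7 ^ t} {n !} {length L} {n / B} {M} (m^n>0 8 t)
            (rare-failure {M} {n} {n / B} 2^[1+M]≤n (m/n*n≤m n B)) L-count
  where
    n = suc m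
    ℓ = ⌊log₂ n ⌋
    t = 12 * ℓ
    B = t * 4
    1≤ℓ : 1 ≤ ℓ
    1≤ℓ = ≤-trans (s≤s z≤n) (2^k≤n⇒k≤⌊log₂n⌋ (suc M) 2^[1+M]≤n)
    instance
      B≢0 : NonZero B
      B≢0 = >-nonZero (≤-trans (s≤s z≤n) (*-monoˡ-≤ 4 (*-monoʳ-≤ 12 1≤ℓ)))
    n≡cB+r : n ≡ n / B * B + n % B
    n≡cB+r = trans (m≡m%n+[m/n]*n n B) (+-comm (n % B) _)
    six-blocks : ∀ ℓ → let B = 12 * ℓ * 4 in (B + B + B) + (B + B + B) ≡ 288 * ℓ
    six-blocks = solve-∀

proposition3p5 : ∃ λ (K : ℕ) → ∀ (m : ℕ) → ∃ λ (N : ℕ) → ∀ (n : ℕ) → N ≤ n →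
    ∃ λ (L : List (Vec (Fin n) n)) →
      Unique L × All (Good K n) L × (m * (n !) ≤ suc m * length L)
proposition3p5 = 288 , λ M → 2 ^ suc M , most-orderings-good M
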